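{- In every nested SQS$(v)$, at least one ND-pair has multiplicity at least $\frac{v-2}{6}$.
   Context: A Steiner quadruple system SQS$(v)$ is a pair $(Q,\mathcal{B})$ where $Q$ is a set of $v$ points and $\mathcal{B}$ is a collection of 4-subsets of $Q$ (blocks) such that every 3-subset of $Q$ is contained in exactly one block. A nested SQS$(v)$ is an SQS$(v)$ together with a partition of each block into two 2-subsets (pairs). A pair of points is an ND-pair if it is one of the two pairs in the partition of at least one block; the multiplicity of a pair is the number of blocks whose partition contains that pair. -}

module Defs where

open import Data.Nat using (ℕ)
open import Data.Fin using (Fin; _≟_)
open import Data.Bool using (Bool; _∧_; _∨_)
open import Data.List using (List; length; filterᵇ)
open import Relation.Nullary using (¬_; ⌊_⌋)
open import Relation.Binary.PropositionalEquality using (_≡_)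

-- A nested block on the point set Fin v: a 4-subset {p₁,p₂,q₁,q₂}
-- (four distinct points) partitioned into the two pairs {p₁,p₂}, {q₁,q₂}.
record NBlock (v : ℕ) : Set where
  field
    p₁ p₂ q₁ q₂ : Fin v
    d₁ : ¬ p₁ ≡ p₂
    d₂ : ¬ p₁ ≡ q₁
    d₃ : ¬ p₁ ≡ q₂
    d₄ : ¬ p₂ ≡ q₁
    d₅ : ¬ p₂ ≡ q₂
    d₆ : ¬ q₁ ≡ q₂
open NBlock public

_==_ : ∀ {v} → Fin v → Fin v → Bool
x == y = ⌊ x ≟ y ⌋

_∈ᵇ_ : ∀ {v} → Fin v → NBlock v → Bool
x ∈ᵇ B = (x == p₁ B) ∨ (x == p₂ B) ∨ (x == q₁ B) ∨ (x == q₂ B)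

samePair : ∀ {v} → Fin v → Fin v → Fin v → Fin v → Bool
samePair x y a b = ((x == a) ∧ (y == b)) ∨ ((x == b) ∧ (y == a))

hasPair : ∀ {v} → Fin v → Fin v → NBlock v → Bool
hasPair x y B = samePair x y (p₁ B) (p₂ B) ∨ samePair x y (q₁ B) (q₂ B)

count : ∀ {v} → (NBlock v → Bool) → List (NBlock v) → ℕ
count P bs = length (filterᵇ P bs)

IsNestedSQS : (v : ℕ) → List (NBlock v) → Set
IsNestedSQS v bs =
  (x y z : Fin v) → ¬ x ≡ y → ¬ x ≡ z → ¬ y ≡ z →
  count (λ B → (x ∈ᵇ B) ∧ (y ∈ᵇ B) ∧ (z ∈ᵇ B)) bs ≡ 1

multiplicity : ∀ {v} → List (NBlock v) → Fin v → Fin v → ℕ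
multiplicity bs x y = count (hasPair x y) bs

{-# OPTIONS --safe #-}
-- Fix a point x and let r be the number of blocks through x. Every ordered pair (y, z) of
-- distinct points other than x lies together with x in exactly one block, and a block through
-- x contains at most 3 · 2 such pairs, so (v - 1)(v - 2) ≤ 6 r. Every block through x has x in
-- one of its two pairs, so r ≤ Σ_{y ≠ x} m(x, y) ≤ (v - 1) · max_y m(x, y). Cancelling v - 1
-- gives v - 2 ≤ 6 · max_y m(x, y).
module Submission where

open import Defs
open import Data.Nat using (ℕ; zero; suc; _≤_; _+_; _*_; z≤n; s≤s)
open import Data.Nat.Properties
  using ( +-*-semiring; +-comm; +-identityʳ; *-identityʳ; *-comm; *-assoc
        ; +-cancelʳ-≡; +-cancelʳ-≤; ≤-refl; ≤-trans; ≤-reflexive; +-mono-≤; +-monoˡ-≤; +-monoʳ-≤; m≤n+m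
        ; *-monoˡ-≤; *-monoʳ-≤; *-cancelˡ-≤; *-cancelˡ-<; n≮0; module ≤-Reasoning )
open import Data.Nat.Solver using (module +-*-Solver)
open import Data.Fin using (Fin; zero; suc; _≟_; punchIn)
open import Data.Fin.Properties using (punchInᵢ≢i)
open import Data.Bool using (Bool; true; false; _∧_; _∨_; not)
open import Data.Bool.Properties using (T-≡; ∨-zeroʳ)
open import Data.List using (List; []; _∷_; length; lookup; allFin)
open import Data.List.Extrema.Nat using (argmax; f[xs]≤f[argmax])
open import Data.List.Membership.Propositional.Properties using (∈-allFin)
import Data.List.Relation.Unary.All as All
open import Data.Product using (Σ; Σ-syntax; _×_; _,_)
open import Data.Sum as Sum using (_⊎_; inj₁; inj₂)
open import Data.Empty using (⊥; ⊥-elim)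
open import Function using (_∘_; Equivalence)
open import Relation.Nullary using (¬_)
open import Relation.Nullary.Decidable using (isYes≗does; dec-true; dec-false; toWitness)
open import Relation.Binary.PropositionalEquality
  using (_≡_; _≢_; ≢-sym; refl; sym; trans; cong; cong₂; subst; module ≡-Reasoning)
open import Algebra.Properties.Semiring.Sum +-*-semiring
  using ( sum; sum-syntax; sum-remove; sum-cong-≗; sum-replicate-zero; ∑-distrib-+; ∑-comm
        ; *-distribˡ-sum; *-distribʳ-sum )

𝟙 : Bool → ℕ
𝟙 true  = 1
𝟙 false = 0

𝟙-∧ : ∀ a b → 𝟙 (a ∧ b) ≡ 𝟙 a * 𝟙 b
𝟙-∧ true  b = sym (+-identityʳ (𝟙 b))
𝟙-∧ false b = refl

𝟙-∨ : ∀ a b → 𝟙 (a ∨ b) ≤ 𝟙 a + 𝟙 b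
𝟙-∨ true  b = s≤s z≤n
𝟙-∨ false b = ≤-refl

𝟙-split : ∀ b m → 𝟙 (not b) * m + 𝟙 b * m ≡ m
𝟙-split true  m = +-identityʳ m
𝟙-split false m = trans (+-identityʳ _) (+-identityʳ m)

𝟙-*-mono : ∀ b {m n} → (b ≡ true → m ≤ n) → 𝟙 b * m ≤ 𝟙 b * n
𝟙-*-mono true  m≤n = *-monoʳ-≤ 1 (m≤n refl)
𝟙-*-mono false _   = z≤n

𝟙-*-cong : ∀ b {m n} → (b ≡ true → m ≡ n) → 𝟙 b * m ≡ 𝟙 b * n
𝟙-*-cong true  m≡n = cong (1 *_) (m≡n refl)
𝟙-*-cong false _   = refl

module _ {n : ℕ} where

  ==-refl : (a : Fin n) → (a == a) ≡ true
  ==-refl a = trans (isYes≗does (a ≟ a)) (dec-true (a ≟ a) refl)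

  ≢⇒==-false : {a b : Fin n} → a ≢ b → (a == b) ≡ false
  ≢⇒==-false {a} {b} a≢b = trans (isYes≗does (a ≟ b)) (dec-false (a ≟ b) a≢b)

  ==⇒≡ : {a b : Fin n} → (a == b) ≡ true → a ≡ b
  ==⇒≡ a==b = toWitness (Equivalence.from T-≡ a==b)

  ==-false⇒≢ : {a b : Fin n} → (a == b) ≡ false → a ≢ b
  ==-false⇒≢ {a} a==a≡false refl with trans (sym (==-refl a)) a==a≡false
  ... | ()

∑-mono-≤ : ∀ {n} {f g : Fin n → ℕ} → (∀ i → f i ≤ g i) → sum f ≤ sum g
∑-mono-≤ {zero}  f≤g = z≤n
∑-mono-≤ {suc n} f≤g = +-mono-≤ (f≤g zero) (∑-mono-≤ (f≤g ∘ suc))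

∑-const : ∀ n c → ∑[ i < n ] c ≡ n * c
∑-const zero    c = refl
∑-const (suc n) c = cong (c +_) (∑-const n c)

∑-pick : ∀ {n} (f : Fin n → ℕ) (a : Fin n) → ∑[ z < n ] (𝟙 (z == a) * f z) ≡ f a
∑-pick {suc n} f a = begin
  ∑[ z < suc n ] (𝟙 (z == a) * f z)
    ≡⟨ sum-remove {i = a} (λ z → 𝟙 (z == a) * f z) ⟩
  𝟙 (a == a) * f a + ∑[ i < n ] (𝟙 (punchIn a i == a) * f (punchIn a i))
    ≡⟨ cong₂ _+_ (cong (λ b → 𝟙 b * f a) (==-refl a))
                 (trans (sum-cong-≗ (λ i → cong (λ b → 𝟙 b * f (punchIn a i))
                                                (≢⇒==-false (punchInᵢ≢i a i))))
                        (sum-replicate-zero n)) ⟩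
  1 * f a + 0
    ≡⟨ trans (+-identityʳ _) (+-identityʳ (f a)) ⟩
  f a ∎
  where open ≡-Reasoning

∑-𝟙== : ∀ {n} (a : Fin n) → ∑[ z < n ] 𝟙 (z == a) ≡ 1
∑-𝟙== a = trans (sum-cong-≗ (λ z → sym (*-identityʳ (𝟙 (z == a))))) (∑-pick (λ _ → 1) a)

∑-punctured : ∀ {n} (f : Fin n → ℕ) (a : Fin n) → ∑[ z < n ] (𝟙 (not (z == a)) * f z) + f a ≡ sum f
∑-punctured {n} f a = begin
  ∑[ z < n ] (𝟙 (not (z == a)) * f z) + f a
    ≡⟨ cong (∑[ z < n ] (𝟙 (not (z == a)) * f z) +_) (sym (∑-pick f a)) ⟩
  ∑[ z < n ] (𝟙 (not (z == a)) * f z) + ∑[ z < n ] (𝟙 (z == a) * f z)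
    ≡⟨ sym (∑-distrib-+ (λ z → 𝟙 (not (z == a)) * f z) (λ z → 𝟙 (z == a) * f z)) ⟩
  ∑[ z < n ] (𝟙 (not (z == a)) * f z + 𝟙 (z == a) * f z)
    ≡⟨ sum-cong-≗ (λ z → 𝟙-split (z == a) (f z)) ⟩
  sum f ∎
  where open ≡-Reasoning

≤-∑ : ∀ {n} (f : Fin n → ℕ) (a : Fin n) → f a ≤ sum f
≤-∑ f a = ≤-trans (m≤n+m (f a) _) (≤-reflexive (∑-punctured f a))

module _ {n k : ℕ} (f : Fin n → ℕ) (a : Fin n) (fa≡1 : f a ≡ 1) where

  private
    punctured+1 : ∑[ z < n ] (𝟙 (not (z == a)) * f z) + 1 ≡ sum f
    punctured+1 = trans (cong (∑[ z < n ] (𝟙 (not (z == a)) * f z) +_) (sym fa≡1)) (∑-punctured f a)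

  ∑-punctured-≡ : sum f ≡ suc k → ∑[ z < n ] (𝟙 (not (z == a)) * f z) ≡ k
  ∑-punctured-≡ ∑f≡ = +-cancelʳ-≡ 1 _ k (trans punctured+1 (trans ∑f≡ (+-comm 1 k)))

  ∑-punctured-≤ : sum f ≤ suc k → ∑[ z < n ] (𝟙 (not (z == a)) * f z) ≤ k
  ∑-punctured-≤ ∑f≤ = +-cancelʳ-≤ 1 _ k
    (≤-trans (≤-reflexive punctured+1) (≤-trans ∑f≤ (≤-reflexive (+-comm 1 k))))

∑-𝟙≢ : ∀ {n} (a : Fin (suc n)) → ∑[ z < suc n ] 𝟙 (not (z == a)) ≡ n
∑-𝟙≢ {n} a = trans (sum-cong-≗ (λ z → sym (*-identityʳ (𝟙 (not (z == a))))))
                   (∑-punctured-≡ (λ _ → 1) a refl (trans (∑-const (suc n) 1) (*-identityʳ (suc n))))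

module _ {v : ℕ} where

  samePair-refl : (a b : Fin v) → samePair a b a b ≡ true
  samePair-refl a b rewrite ==-refl a | ==-refl b = refl

  samePair-swap : (a b : Fin v) → samePair b a a b ≡ true
  samePair-swap a b rewrite ==-refl a | ==-refl b = ∨-zeroʳ _

  samePair-diag : {a b : Fin v} → a ≢ b → (x : Fin v) → samePair x x a b ≡ false
  samePair-diag {a} {b} a≢b x =
    exclusive (x == a) (x == b) (λ x≡a x≡b → a≢b (trans (sym (==⇒≡ x≡a)) (==⇒≡ x≡b)))
    where
    exclusive : ∀ p q → (p ≡ true → q ≡ true → ⊥) → (p ∧ q) ∨ (q ∧ p) ≡ false
    exclusive true  true  ¬both = ⊥-elim (¬both refl refl)
    exclusive true  false _     = refl
    exclusive false true  _     = refl
    exclusive false false _     = refl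

  hasPair-diag : (x : Fin v) (B : NBlock v) → hasPair x x B ≡ false
  hasPair-diag x B = cong₂ _∨_ (samePair-diag (d₁ B) x) (samePair-diag (d₆ B) x)

  ∈ᵇ-cases : {x : Fin v} (B : NBlock v) → (x ∈ᵇ B) ≡ true →
             x ≡ p₁ B ⊎ x ≡ p₂ B ⊎ x ≡ q₁ B ⊎ x ≡ q₂ B
  ∈ᵇ-cases B x∈B =
    Sum.map ==⇒≡ (Sum.map ==⇒≡ (Sum.map ==⇒≡ ==⇒≡ ∘ ∨-cases) ∘ ∨-cases) (∨-cases x∈B)
    where
    ∨-cases : ∀ {p q} → p ∨ q ≡ true → p ≡ true ⊎ q ≡ true
    ∨-cases {true}  _   = inj₁ refl
    ∨-cases {false} q≡t = inj₂ q≡t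

  partner : {x : Fin v} (B : NBlock v) → (x ∈ᵇ B) ≡ true → Σ[ y ∈ Fin v ] hasPair x y B ≡ true
  partner {x} B x∈B = pick (∈ᵇ-cases B x∈B)
    where
    viaP : ∀ {y} → samePair x y (p₁ B) (p₂ B) ≡ true → hasPair x y B ≡ true
    viaP {y} = cong (_∨ samePair x y (q₁ B) (q₂ B))
    viaQ : ∀ {y} → samePair x y (q₁ B) (q₂ B) ≡ true → hasPair x y B ≡ true
    viaQ {y} e = trans (cong (samePair x y (p₁ B) (p₂ B) ∨_) e) (∨-zeroʳ _)
    pick : x ≡ p₁ B ⊎ x ≡ p₂ B ⊎ x ≡ q₁ B ⊎ x ≡ q₂ B → Σ[ y ∈ Fin v ] hasPair x y B ≡ true
    pick (inj₁ refl)               = p₂ B , viaP (samePair-refl (p₁ B) (p₂ B))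
    pick (inj₂ (inj₁ refl))        = p₁ B , viaP (samePair-swap (p₁ B) (p₂ B))
    pick (inj₂ (inj₂ (inj₁ refl))) = q₂ B , viaQ (samePair-refl (q₁ B) (q₂ B))
    pick (inj₂ (inj₂ (inj₂ refl))) = q₁ B , viaQ (samePair-swap (q₁ B) (q₂ B))

  ∑-∈ᵇ≤4 : (B : NBlock v) → ∑[ z < v ] 𝟙 (z ∈ᵇ B) ≤ 4
  ∑-∈ᵇ≤4 B = begin
    ∑[ z < v ] 𝟙 (z ∈ᵇ B)                ≤⟨ ∑-mono-≤ split ⟩
    ∑[ z < v ] (at p₁ z + (at p₂ z + (at q₁ z + at q₂ z)))
      ≡⟨ trans (∑-distrib-+ (at p₁) _) (cong₂ _+_ (∑-𝟙== (p₁ B))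
         (trans (∑-distrib-+ (at p₂) _) (cong₂ _+_ (∑-𝟙== (p₂ B))
         (trans (∑-distrib-+ (at q₁) _) (cong₂ _+_ (∑-𝟙== (q₁ B)) (∑-𝟙== (q₂ B))))))) ⟩
    4 ∎
    where
    open ≤-Reasoning
    at : (NBlock v → Fin v) → Fin v → ℕ
    at point z = 𝟙 (z == point B)
    split : ∀ z → 𝟙 (z ∈ᵇ B) ≤ at p₁ z + (at p₂ z + (at q₁ z + at q₂ z))
    split z = ≤-trans (𝟙-∨ (z == p₁ B) _) (+-monoʳ-≤ (at p₁ z)
              (≤-trans (𝟙-∨ (z == p₂ B) _) (+-monoʳ-≤ (at p₂ z) (𝟙-∨ (z == q₁ B) _))))

  𝟙-∈ᵇ≤∑-hasPair : (x : Fin v) (B : NBlock v) → 𝟙 (x ∈ᵇ B) ≤ ∑[ y < v ] 𝟙 (hasPair x y B)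
  𝟙-∈ᵇ≤∑-hasPair x B with x ∈ᵇ B in x∈B
  ... | false = z≤n
  ... | true  with partner {x} B x∈B
  ...   | y , xy∈B = ≤-trans (≤-reflexive (cong 𝟙 (sym xy∈B))) (≤-∑ (λ t → 𝟙 (hasPair x t B)) y)

distinct₃ : ∀ {v} → Fin v → Fin v → Fin v → ℕ
distinct₃ x y z = 𝟙 (not (y == x)) * (𝟙 (not (z == y)) * 𝟙 (not (z == x)))

∑-distinct₃ : ∀ {w} (x : Fin (2 + w)) → ∑[ y < 2 + w ] ∑[ z < 2 + w ] distinct₃ x y z ≡ (1 + w) * w
∑-distinct₃ {w} x = begin
  ∑[ y < 2 + w ] ∑[ z < 2 + w ] distinct₃ x y z
    ≡⟨ sum-cong-≗ (λ y → sym (*-distribˡ-sum (𝟙 (not (y == x))) (λ z → 𝟙 (not (z == y)) * 𝟙 (not (z == x))))) ⟩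
  ∑[ y < 2 + w ] (𝟙 (not (y == x)) * ∑[ z < 2 + w ] (𝟙 (not (z == y)) * 𝟙 (not (z == x))))
    ≡⟨ sum-cong-≗ (λ y → 𝟙-*-cong (not (y == x))
         (λ y≢x → ∑-punctured-≡ (λ z → 𝟙 (not (z == x))) y (cong 𝟙 y≢x) (∑-𝟙≢ x))) ⟩
  ∑[ y < 2 + w ] (𝟙 (not (y == x)) * w)
    ≡⟨ sym (*-distribʳ-sum w (λ y → 𝟙 (not (y == x)))) ⟩
  ∑[ y < 2 + w ] 𝟙 (not (y == x)) * w
    ≡⟨ cong (_* w) (∑-𝟙≢ x) ⟩
  (1 + w) * w ∎
  where open ≡-Reasoning

module _ {v : ℕ} (x : Fin v) (B : NBlock v) where

  otherPoint : Fin v → Bool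
  otherPoint y = not (y == x) ∧ (y ∈ᵇ B)

  otherPointsAvoiding : Fin v → ℕ
  otherPointsAvoiding y = ∑[ z < v ] (𝟙 (not (z == y)) * 𝟙 (otherPoint z))

  ∑-otherPoint≤3 : (x ∈ᵇ B) ≡ true → ∑[ y < v ] 𝟙 (otherPoint y) ≤ 3
  ∑-otherPoint≤3 x∈B = begin
    ∑[ y < v ] 𝟙 (otherPoint y)                  ≡⟨ sum-cong-≗ (λ y → 𝟙-∧ (not (y == x)) (y ∈ᵇ B)) ⟩
    ∑[ y < v ] (𝟙 (not (y == x)) * 𝟙 (y ∈ᵇ B))   ≤⟨ ∑-punctured-≤ (λ y → 𝟙 (y ∈ᵇ B)) x (cong 𝟙 x∈B) (∑-∈ᵇ≤4 B) ⟩
    3 ∎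
    where open ≤-Reasoning

  orderedPairs≤6 : (x ∈ᵇ B) ≡ true → ∑[ y < v ] (𝟙 (otherPoint y) * otherPointsAvoiding y) ≤ 6
  orderedPairs≤6 x∈B = begin
    ∑[ y < v ] (𝟙 (otherPoint y) * otherPointsAvoiding y)
      ≤⟨ ∑-mono-≤ (λ y → 𝟙-*-mono (otherPoint y)
           (λ y∈B → ∑-punctured-≤ (𝟙 ∘ otherPoint) y (cong 𝟙 y∈B) others≤3)) ⟩
    ∑[ y < v ] (𝟙 (otherPoint y) * 2)    ≡⟨ sym (*-distribʳ-sum 2 (𝟙 ∘ otherPoint)) ⟩
    ∑[ y < v ] 𝟙 (otherPoint y) * 2      ≤⟨ *-monoˡ-≤ 2 others≤3 ⟩
    6 ∎
    where
    open ≤-Reasoning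
    others≤3 : ∑[ y < v ] 𝟙 (otherPoint y) ≤ 3
    others≤3 = ∑-otherPoint≤3 x∈B

  blockContribution :
    ∑[ y < v ] ∑[ z < v ] (distinct₃ x y z * 𝟙 ((x ∈ᵇ B) ∧ (y ∈ᵇ B) ∧ (z ∈ᵇ B))) ≤ 𝟙 (x ∈ᵇ B) * 6
  blockContribution = begin
    ∑[ y < v ] ∑[ z < v ] (distinct₃ x y z * 𝟙 ((x ∈ᵇ B) ∧ (y ∈ᵇ B) ∧ (z ∈ᵇ B)))
      ≡⟨ sum-cong-≗ (λ y → trans (sum-cong-≗ (regroup y))
           (sym (*-distribˡ-sum (𝟙 (x ∈ᵇ B) * 𝟙 (otherPoint y)) (λ z → 𝟙 (not (z == y)) * 𝟙 (otherPoint z))))) ⟩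
    ∑[ y < v ] (𝟙 (x ∈ᵇ B) * 𝟙 (otherPoint y) * otherPointsAvoiding y)
      ≡⟨ sum-cong-≗ (λ y → *-assoc (𝟙 (x ∈ᵇ B)) (𝟙 (otherPoint y)) (otherPointsAvoiding y)) ⟩
    ∑[ y < v ] (𝟙 (x ∈ᵇ B) * (𝟙 (otherPoint y) * otherPointsAvoiding y))
      ≡⟨ sym (*-distribˡ-sum (𝟙 (x ∈ᵇ B)) (λ y → 𝟙 (otherPoint y) * otherPointsAvoiding y)) ⟩
    𝟙 (x ∈ᵇ B) * ∑[ y < v ] (𝟙 (otherPoint y) * otherPointsAvoiding y)
      ≤⟨ 𝟙-*-mono (x ∈ᵇ B) orderedPairs≤6 ⟩
    𝟙 (x ∈ᵇ B) * 6 ∎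
    where
    open ≤-Reasoning
    open +-*-Solver
    regroup : ∀ y z → distinct₃ x y z * 𝟙 ((x ∈ᵇ B) ∧ (y ∈ᵇ B) ∧ (z ∈ᵇ B))
              ≡ 𝟙 (x ∈ᵇ B) * 𝟙 (otherPoint y) * (𝟙 (not (z == y)) * 𝟙 (otherPoint z))
    regroup y z = begin-equality
      distinct₃ x y z * 𝟙 ((x ∈ᵇ B) ∧ (y ∈ᵇ B) ∧ (z ∈ᵇ B))
        ≡⟨ cong (distinct₃ x y z *_) (trans (𝟙-∧ (x ∈ᵇ B) _) (cong (𝟙 (x ∈ᵇ B) *_) (𝟙-∧ (y ∈ᵇ B) (z ∈ᵇ B)))) ⟩
      𝟙 y≢x * (𝟙 z≢y * 𝟙 z≢x) * (𝟙 (x ∈ᵇ B) * (𝟙 (y ∈ᵇ B) * 𝟙 (z ∈ᵇ B)))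
        ≡⟨ solve 6 (λ a c d X Y Z → (a :* (c :* d)) :* (X :* (Y :* Z)) := X :* (a :* Y) :* (c :* (d :* Z)))
                 refl (𝟙 y≢x) (𝟙 z≢y) (𝟙 z≢x) (𝟙 (x ∈ᵇ B)) (𝟙 (y ∈ᵇ B)) (𝟙 (z ∈ᵇ B)) ⟩
      𝟙 (x ∈ᵇ B) * (𝟙 y≢x * 𝟙 (y ∈ᵇ B)) * (𝟙 z≢y * (𝟙 z≢x * 𝟙 (z ∈ᵇ B)))
        ≡⟨ sym (cong₂ (λ m n → 𝟙 (x ∈ᵇ B) * m * (𝟙 z≢y * n)) (𝟙-∧ y≢x (y ∈ᵇ B)) (𝟙-∧ z≢x (z ∈ᵇ B))) ⟩
      𝟙 (x ∈ᵇ B) * 𝟙 (otherPoint y) * (𝟙 z≢y * 𝟙 (otherPoint z)) ∎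
      where
      y≢x z≢y z≢x : Bool
      y≢x = not (y == x)
      z≢y = not (z == y)
      z≢x = not (z == x)

count≡∑ : ∀ {v} (P : NBlock v → Bool) (bs : List (NBlock v)) →
          count P bs ≡ ∑[ i < length bs ] 𝟙 (P (lookup bs i))
count≡∑ P []       = refl
count≡∑ P (B ∷ bs) with P B
... | true  = cong suc (count≡∑ P bs)
... | false = count≡∑ P bs

multiplicity-diag : ∀ {v} (bs : List (NBlock v)) (x : Fin v) → multiplicity bs x x ≡ 0
multiplicity-diag bs x =
  trans (count≡∑ (hasPair x x) bs)
        (trans (sum-cong-≗ (λ i → cong 𝟙 (hasPair-diag x (lookup bs i)))) (sum-replicate-zero (length bs)))

module _ {w : ℕ} (bs : List (NBlock (2 + w))) (sqs : IsNestedSQS (2 + w) bs) (x : Fin (2 + w)) where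

  private
    block : Fin (length bs) → NBlock (2 + w)
    block = lookup bs

    replication : ℕ
    replication = count (x ∈ᵇ_) bs

  distinct₃-covered : ∀ y z →
    distinct₃ x y z ≤ distinct₃ x y z * ∑[ i < length bs ] 𝟙 ((x ∈ᵇ block i) ∧ (y ∈ᵇ block i) ∧ (z ∈ᵇ block i))
  distinct₃-covered y z with y == x in y==x | z == y in z==y | z == x in z==x
  ... | true  | _     | _     = z≤n
  ... | false | true  | _     = z≤n
  ... | false | false | true  = z≤n
  ... | false | false | false = ≤-reflexive (sym (trans (+-identityʳ _) (trans (sym (count≡∑ _ bs))
          (sqs x y z (≢-sym (==-false⇒≢ y==x)) (≢-sym (==-false⇒≢ z==x)) (≢-sym (==-false⇒≢ z==y))))))

  ∑-distinct₃≤ : ∑[ y < 2 + w ] ∑[ z < 2 + w ] distinct₃ x y z ≤ replication * 6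
  ∑-distinct₃≤ = begin
    ∑[ y < 2 + w ] ∑[ z < 2 + w ] distinct₃ x y z
      ≤⟨ ∑-mono-≤ (λ y → ∑-mono-≤ (distinct₃-covered y)) ⟩
    ∑[ y < 2 + w ] ∑[ z < 2 + w ] (distinct₃ x y z * ∑[ i < length bs ] inBlock i y z)
      ≡⟨ sum-cong-≗ (λ y → sum-cong-≗ (λ z → *-distribˡ-sum (distinct₃ x y z) (λ i → inBlock i y z))) ⟩
    ∑[ y < 2 + w ] ∑[ z < 2 + w ] ∑[ i < length bs ] (distinct₃ x y z * inBlock i y z)
      ≡⟨ sum-cong-≗ (λ y → ∑-comm (λ z i → distinct₃ x y z * inBlock i y z)) ⟩
    ∑[ y < 2 + w ] ∑[ i < length bs ] ∑[ z < 2 + w ] (distinct₃ x y z * inBlock i y z)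
      ≡⟨ ∑-comm (λ y i → ∑[ z < 2 + w ] (distinct₃ x y z * inBlock i y z)) ⟩
    ∑[ i < length bs ] ∑[ y < 2 + w ] ∑[ z < 2 + w ] (distinct₃ x y z * inBlock i y z)
      ≤⟨ ∑-mono-≤ (λ i → blockContribution x (block i)) ⟩
    ∑[ i < length bs ] (𝟙 (x ∈ᵇ block i) * 6)
      ≡⟨ sym (*-distribʳ-sum 6 (λ i → 𝟙 (x ∈ᵇ block i))) ⟩
    ∑[ i < length bs ] 𝟙 (x ∈ᵇ block i) * 6
      ≡⟨ cong (_* 6) (sym (count≡∑ (x ∈ᵇ_) bs)) ⟩
    replication * 6 ∎
    where
    open ≤-Reasoning
    inBlock : Fin (length bs) → Fin (2 + w) → Fin (2 + w) → ℕ
    inBlock i y z = 𝟙 ((x ∈ᵇ block i) ∧ (y ∈ᵇ block i) ∧ (z ∈ᵇ block i))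

  replication≤ : replication ≤ ∑[ y < 2 + w ] (𝟙 (not (y == x)) * multiplicity bs x y)
  replication≤ = begin
    replication                                            ≡⟨ count≡∑ (x ∈ᵇ_) bs ⟩
    ∑[ i < length bs ] 𝟙 (x ∈ᵇ block i)                    ≤⟨ ∑-mono-≤ (λ i → 𝟙-∈ᵇ≤∑-hasPair x (block i)) ⟩
    ∑[ i < length bs ] ∑[ y < 2 + w ] 𝟙 (hasPair x y (block i))
      ≡⟨ ∑-comm (λ i y → 𝟙 (hasPair x y (block i))) ⟩
    ∑[ y < 2 + w ] ∑[ i < length bs ] 𝟙 (hasPair x y (block i))
      ≡⟨ sum-cong-≗ (λ y → sym (count≡∑ (hasPair x y) bs)) ⟩
    ∑[ y < 2 + w ] multiplicity bs x y
      ≡⟨ sym (∑-punctured (multiplicity bs x) x) ⟩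
    ∑[ y < 2 + w ] (𝟙 (not (y == x)) * multiplicity bs x y) + multiplicity bs x x
      ≡⟨ trans (cong (∑[ y < 2 + w ] (𝟙 (not (y == x)) * multiplicity bs x y) +_) (multiplicity-diag bs x))
               (+-identityʳ _) ⟩
    ∑[ y < 2 + w ] (𝟙 (not (y == x)) * multiplicity bs x y) ∎
    where open ≤-Reasoning

  heaviestPartner : Fin (2 + w)
  heaviestPartner = argmax (multiplicity bs x) x (allFin (2 + w))

  ∑-multiplicity≤ : ∑[ y < 2 + w ] (𝟙 (not (y == x)) * multiplicity bs x y) ≤
                    (1 + w) * multiplicity bs x heaviestPartner
  ∑-multiplicity≤ = begin
    ∑[ y < 2 + w ] (𝟙 (not (y == x)) * multiplicity bs x y)
      ≤⟨ ∑-mono-≤ (λ y → *-monoʳ-≤ (𝟙 (not (y == x)))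
           (All.lookup (f[xs]≤f[argmax] {f = multiplicity bs x} x (allFin (2 + w))) (∈-allFin y))) ⟩
    ∑[ y < 2 + w ] (𝟙 (not (y == x)) * M)   ≡⟨ sym (*-distribʳ-sum M (λ y → 𝟙 (not (y == x)))) ⟩
    ∑[ y < 2 + w ] 𝟙 (not (y == x)) * M     ≡⟨ cong (_* M) (∑-𝟙≢ x) ⟩
    (1 + w) * M ∎
    where
    open ≤-Reasoning
    M : ℕ
    M = multiplicity bs x heaviestPartner

  heaviestPartner-multiplicity : w ≤ 6 * multiplicity bs x heaviestPartner
  heaviestPartner-multiplicity = *-cancelˡ-≤ (1 + w) (begin
    (1 + w) * w                                    ≡⟨ sym (∑-distinct₃ x) ⟩
    ∑[ y < 2 + w ] ∑[ z < 2 + w ] distinct₃ x y z  ≤⟨ ∑-distinct₃≤ ⟩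
    replication * 6                                ≤⟨ *-monoˡ-≤ 6 (≤-trans replication≤ ∑-multiplicity≤) ⟩
    (1 + w) * M * 6                                ≡⟨ *-assoc (1 + w) M 6 ⟩
    (1 + w) * (M * 6)                              ≡⟨ cong ((1 + w) *_) (*-comm M 6) ⟩
    (1 + w) * (6 * M) ∎)
    where
    open ≤-Reasoning
    M : ℕ
    M = multiplicity bs x heaviestPartner

lemma2p10 : (v : ℕ) → 4 ≤ v → (bs : List (NBlock v)) → IsNestedSQS v bs →
    Σ (Fin v) (λ x → Σ (Fin v) (λ y →
      ¬ x ≡ y × 1 ≤ multiplicity bs x y × v ≤ 6 * multiplicity bs x y + 2))
lemma2p10 (suc (suc w)) (s≤s (s≤s 2≤w)) bs sqs = x , y , x≢y , 1≤m , v≤6m+2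
  where
  x y : Fin (2 + w)
  x = zero
  y = heaviestPartner bs sqs x
  w≤6m : w ≤ 6 * multiplicity bs x y
  w≤6m = heaviestPartner-multiplicity bs sqs x
  1≤m : 1 ≤ multiplicity bs x y
  1≤m = *-cancelˡ-< 6 0 (multiplicity bs x y) (≤-trans (s≤s z≤n) (≤-trans 2≤w w≤6m))
  x≢y : x ≢ y
  x≢y x≡y = n≮0 (subst (1 ≤_) (trans (cong (multiplicity bs x) (sym x≡y)) (multiplicity-diag bs x)) 1≤m)
  v≤6m+2 : 2 + w ≤ 6 * multiplicity bs x y + 2
  v≤6m+2 = ≤-trans (≤-reflexive (+-comm 2 w)) (+-monoˡ-≤ 2 w≤6m)
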